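{- Let $A$ be a finite set and $\mathcal C$ a function clone on $A$. The following are equivalent: (1) there is a finite set $\Sigma$ of relation pairs on $(A,A)$ with $\mathcal C=\mathrm{Pol}(\Sigma)$; (2) there is a finite set $\Sigma'$ of relations on $A$ with $\mathcal C=\mathrm{Pol}(\{(R,R):R\in\Sigma'\})$.
   Context: For $n\ge1$ let $\mathcal O(A)_n$ be the set of functions $A^n\to A$. A function clone on $A$ is a family $\mathcal C_n\subseteq\mathcal O(A)_n$ that contains the identity $\mathrm{id}_A\in\mathcal C_1$, is closed under minors (for $f\in\mathcal C_n$ and any map $\alpha:\{0,..,n-1\}\to\{0,..,k-1\}$, the function $(x_0,\dots,x_{k-1})\mapsto f(x_{\alpha(0)},\dots,x_{\alpha(n-1)})$ is in $\mathcal C_k$), and closed under composition ($f\in\mathcal C_n$, $g_0,\dots,g_{n-1}\in\mathcal C_l$ imply $x\mapsto f(g_0(x),\dots,g_{n-1}(x))$ is in $\mathcal C_l$). A relation pair on $(A,A)$ of finite arity set $Y$ is $(R,S)$ with $R,S\subseteq A^Y$; $f:A^n\to A$ preserves it if for all $r_0,\dots,r_{n-1}\in R$, $(f(r_0(y),\dots,r_{n-1}(y)))_{y\in Y}\in S$. $\mathrm{Pol}(\Sigma)_n$ is the set of $n$-ary functions preserving every pair in $\Sigma$. -}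

module Defs where

open import Level using (Level; _⊔_) renaming (zero to lzero)
open import Data.Nat using (ℕ; zero; suc)
open import Data.Fin using (Fin)
open import Data.Bool using (Bool; true)
open import Data.Vec using (Vec; lookup; tabulate)
open import Data.List using (List; map)
open import Data.List.Membership.Propositional using (_∈_)
open import Data.Product using (Σ; _×_; _,_)
open import Relation.Binary.PropositionalEquality using (_≡_)

-- The finite base set A is Fin k.
-- n-ary operations on A (tuples in A^n are vectors of length n).
Op : ℕ → ℕ → Set
Op k n = Vec (Fin k) n → Fin k

-- A relation of arity set Y = Fin m on A: a subset of A^Y, given by its
-- (Boolean) characteristic function (A is finite, so every subset is decidable).
Rel : ℕ → ℕ → Set
Rel k m = Vec (Fin k) m → Bool

RelPair : ℕ → Set
RelPair k = Σ ℕ (λ m → Rel k m × Rel k m)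

diag : ∀ {k} → Σ ℕ (Rel k) → RelPair k
diag (m , R) = m , R , R

Preserves : ∀ {k n} → Op k n → RelPair k → Set
Preserves {k} {n} f (m , R , S) =
  (rs : Fin n → Vec (Fin k) m) →
  ((i : Fin n) → R (rs i) ≡ true) →
  S (tabulate (λ y → f (tabulate (λ i → lookup (rs i) y)))) ≡ true

Pol : ∀ {k} → List (RelPair k) → (n : ℕ) → Op k n → Set
Pol Σs n f = ∀ {P} → P ∈ Σs → Preserves f P

-- Function clones on Fin k. Arities are n ≥ 1, so the family is indexed
-- by n : ℕ with C n ⊆ Op k (suc n) (i.e. C n is the set of (n+1)-ary members).
record IsClone {ℓ : Level} (k : ℕ) (C : (n : ℕ) → Op k (suc n) → Set ℓ) : Set ℓ where
  field
    identity : C 0 (λ x → lookup x Fin.zero)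
    minor    : ∀ {n l} {f : Op k (suc n)} → C n f →
               (α : Fin (suc n) → Fin (suc l)) →
               C l (λ x → f (tabulate (λ i → lookup x (α i))))
    compose  : ∀ {n l} {f : Op k (suc n)} → C n f →
               (g : Fin (suc n) → Op k (suc l)) → ((i : Fin (suc n)) → C l (g i)) →
               C l (λ x → f (tabulate (λ i → g i x)))

_≐Pol_ : ∀ {ℓ k} → ((n : ℕ) → Op k (suc n) → Set ℓ) → List (RelPair k) → Set ℓ
C ≐Pol Σs = ∀ n (f : Op _ (suc n)) → (C n f → Pol Σs (suc n) f) × (Pol Σs (suc n) f → C n f)

{-# OPTIONS --safe #-}
-- For (1) ⇒ (2), replace each pair (R , S) ∈ Σ of
-- arity m by the relation C⁽ᴺ⁾ ⊆ A^(A^N), N = 1 + |A|^m, of tables of the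
-- N-ary members of C. Every member of C preserves C⁽ᴺ⁾ since C is closed
-- under composition. Conversely, if f preserves every C⁽ᴺ⁾ and r₀ … rₙ ∈ R,
-- list all of R as an N-tuple ρ; applying f to the projections that pick the
-- rᵢ out of ρ gives an N-ary member h of C with f(r₀, …, rₙ) = h(ρ), and h
-- preserves (R , S).
module Submission where

open import Defs
open import Level using (Level)
open import Data.Nat using (ℕ; suc; _^_)
open import Data.Fin using (Fin; funToFin; finToFun) renaming (zero to fzero; suc to fsuc)
open import Data.Fin.Properties using (all?; finToFun-funToFin)
open import Data.Bool using (true; false; if_then_else_)
open import Data.Bool.Properties using (T-≡) renaming (_≟_ to _≟ᵇ_)
open import Data.Vec using (Vec; []; _∷_; lookup; tabulate)
open import Data.Vec.Properties using (lookup∘tabulate; tabulate∘lookup; tabulate-cong)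
open import Data.List using (List; map)
open import Data.List.Membership.Propositional using (_∈_)
open import Data.List.Relation.Unary.All as All using (All)
open import Data.List.Relation.Unary.All.Properties using (map⁺; map⁻)
open import Data.Product using (Σ; ∃; _,_; proj₁; proj₂)
open import Function using (_∘_; _⇔_; mk⇔; Equivalence)
open import Relation.Nullary using (Dec)
open import Relation.Nullary.Decidable using (map′; _→-dec_; isYes; toWitness; fromWitness)
open import Relation.Binary.PropositionalEquality
  using (_≡_; _≗_; refl; sym; trans; cong; module ≡-Reasoning)

Searchable : Set → Set₁
Searchable X = ∀ {Q : X → Set} → (∀ x → Dec (Q x)) → Dec (∀ x → Q x)

Searchable-Vec : ∀ {X} → Searchable X → ∀ n → Searchable (Vec X n)
Searchable-Vec search 0       Q? = map′ (λ { q [] → q }) (λ h → h []) (Q? [])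
Searchable-Vec search (suc n) Q? =
  map′ (λ { h (x ∷ v) → h x v }) (λ h x v → h (x ∷ v))
       (search (λ x → Searchable-Vec search n (Q? ∘ (x ∷_))))

encode : ∀ {k m} → Vec (Fin k) m → Fin (k ^ m)
encode v = funToFin (lookup v)

decode : ∀ {k m} → Fin (k ^ m) → Vec (Fin k) m
decode j = tabulate (finToFun j)

decode-encode : ∀ {k m} (v : Vec (Fin k) m) → decode (encode v) ≡ v
decode-encode v = trans (tabulate-cong (finToFun-funToFin (lookup v))) (tabulate∘lookup v)

table : ∀ {k N} → Op k N → Vec (Fin k) (k ^ N)
table g = tabulate (g ∘ decode)

fromTable : ∀ {k} N → Vec (Fin k) (k ^ N) → Op k N
fromTable N t = lookup t ∘ encode

fromTable-table : ∀ {k N} (g : Op k N) → fromTable N (table g) ≗ g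
fromTable-table g x = trans (lookup∘tabulate (g ∘ decode) (encode x)) (cong g (decode-encode x))

column : ∀ {A : Set} {n m} → (Fin n → Vec A m) → Fin m → Vec A n
column rs y = tabulate (λ i → lookup (rs i) y)

apply : ∀ {k n m} → Op k n → (Fin n → Vec (Fin k) m) → Vec (Fin k) m
apply f rs = tabulate (f ∘ column rs)

apply-cong : ∀ {k n m} (f : Op k n) {rs rs′ : Fin n → Vec (Fin k) m} →
             rs ≗ rs′ → apply f rs ≡ apply f rs′
apply-cong f e =
  tabulate-cong (λ y → cong f (tabulate-cong (λ i → cong (λ v → lookup v y) (e i))))

fromTable-apply : ∀ {k n} N (f : Op k n) (ts : Fin n → Vec (Fin k) (k ^ N)) →
                  fromTable N (apply f ts) ≗ (λ x → f (tabulate (λ i → fromTable N (ts i) x)))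
fromTable-apply N f ts x = lookup∘tabulate (f ∘ column ts) (encode x)

Preserves-cong : ∀ {k n} {f g : Op k n} {P : RelPair k} → f ≗ g → Preserves f P → Preserves g P
Preserves-cong {P = m , R , S} e p rs rs∈R =
  trans (cong S (sym (tabulate-cong (e ∘ column rs)))) (p rs rs∈R)

Pol-cong : ∀ {k n} {Σs : List (RelPair k)} {f g : Op k n} → f ≗ g → Pol Σs n f → Pol Σs n g
Pol-cong e p {P} P∈Σs = Preserves-cong {P = P} e (p P∈Σs)

preserves? : ∀ {k n} (f : Op k n) (P : RelPair k) → Dec (Preserves f P)
preserves? {k} {n} f (m , R , S) =
  map′ (λ h rs → Q-resp (lookup∘tabulate rs) (h (tabulate rs))) (λ h → h ∘ lookup)
       (Searchable-Vec (Searchable-Vec all? m) n (Q? ∘ lookup))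
  where
  Q : (Fin n → Vec (Fin k) m) → Set
  Q rs = (∀ i → R (rs i) ≡ true) → S (apply f rs) ≡ true

  Q? : ∀ rs → Dec (Q rs)
  Q? rs = all? (λ i → R (rs i) ≟ᵇ true) →-dec (S (apply f rs) ≟ᵇ true)

  Q-resp : ∀ {rs rs′} → rs ≗ rs′ → Q rs → Q rs′
  Q-resp e q rs′∈R =
    trans (cong S (sym (apply-cong f e))) (q (λ i → trans (cong R (e i)) (rs′∈R i)))

pol? : ∀ {k n} (f : Op k n) (Σs : List (RelPair k)) → Dec (Pol Σs n f)
pol? f Σs = map′ All.lookup All.tabulate (All.all? (preserves? f) Σs)

Pol-map-diag⁻ : ∀ {k n} {X : Set} {f : Op k n} (h : X → Σ ℕ (Rel k)) (L : List X) →
                Pol (map diag (map h L)) n f → ∀ {x} → x ∈ L → Preserves f (diag (h x))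
Pol-map-diag⁻ {f = f} h L p = All.lookup (map⁻ {P = Preserves f ∘ diag} (map⁻ (All.tabulate p)))

Pol-map-diag⁺ : ∀ {k n} {X : Set} {f : Op k n} (h : X → Σ ℕ (Rel k)) (L : List X) →
                (∀ {x} → x ∈ L → Preserves f (diag (h x))) → Pol (map diag (map h L)) n f
Pol-map-diag⁺ {f = f} h L p = All.lookup (map⁺ (map⁺ {P = Preserves f ∘ diag} (All.tabulate p)))

-- The relation C⁽ᴺ⁾ of the proof idea, defined through Pol Σ (which equals C)
-- because a relation must be a decidable predicate.
module _ {k : ℕ} (Σs : List (RelPair k)) where

  polTables : (N : ℕ) → Rel k (k ^ N)
  polTables N t = isYes (pol? (fromTable N t) Σs)

  polTables-sound : ∀ {N} {t} → polTables N t ≡ true → Pol Σs N (fromTable N t)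
  polTables-sound {N} {t} e = toWitness {a? = pol? (fromTable N t) Σs} (Equivalence.from T-≡ e)

  polTables-complete : ∀ {N} {t} → Pol Σs N (fromTable N t) → polTables N t ≡ true
  polTables-complete {N} {t} p = Equivalence.to T-≡ (fromWitness {a? = pol? (fromTable N t) Σs} p)

  table∈polTables : ∀ {N} (g : Op k N) → Pol Σs N g → polTables N (table g) ≡ true
  table∈polTables g p = polTables-complete {t = table g} (Pol-cong (sym ∘ fromTable-table g) p)

  polTablesRel : ℕ → Σ ℕ (Rel k)
  polTablesRel N = k ^ N , polTables N

  polTablesFor : RelPair k → Σ ℕ (Rel k)
  polTablesFor (m , _) = polTablesRel (suc (k ^ m))

-- The padding by r₀ handles the tuples outside R, and the extra first
-- coordinate keeps the arity positive, as members of a clone have arity ≥ 1.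
module Listing {k m} (R : Rel k m) {r₀} (r₀∈R : R r₀ ≡ true) where

  listing : Fin (suc (k ^ m)) → Vec (Fin k) m
  listing fzero    = r₀
  listing (fsuc j) = if R (decode j) then decode j else r₀

  listing-∈ : ∀ j → R (listing j) ≡ true
  listing-∈ fzero = r₀∈R
  listing-∈ (fsuc j) with R (decode j) in e
  ... | true  = e
  ... | false = r₀∈R

  listing-encode : ∀ {v} → R v ≡ true → listing (fsuc (encode v)) ≡ v
  listing-encode {v} v∈R rewrite decode-encode v | v∈R = refl

module _ {ℓ : Level} {k : ℕ} {C : (n : ℕ) → Op k (suc n) → Set ℓ} (isClone : IsClone k C)
         {Σs : List (RelPair k)} (C≐Pol : C ≐Pol Σs) where
  open IsClone isClone

  private
    C⊆Pol : ∀ {n} (f : Op k (suc n)) → C n f → Pol Σs (suc n) f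
    C⊆Pol f = proj₁ (C≐Pol _ f)

    Pol⊆C : ∀ {n} (f : Op k (suc n)) → Pol Σs (suc n) f → C n f
    Pol⊆C f = proj₂ (C≐Pol _ f)

  C-preserves-polTables : ∀ {n} N (f : Op k (suc n)) → C n f →
                          Preserves f (diag (polTablesRel Σs (suc N)))
  C-preserves-polTables N f f∈C ts ts∈polTables =
    polTables-complete Σs {t = apply f ts}
      (Pol-cong (sym ∘ fromTable-apply (suc N) f ts) (C⊆Pol _ composite∈C))
    where
    composite∈C : C N (λ x → f (tabulate (λ i → fromTable (suc N) (ts i) x)))
    composite∈C = compose f∈C (fromTable (suc N) ∘ ts)
      (λ i → Pol⊆C (fromTable (suc N) (ts i)) (polTables-sound Σs {t = ts i} (ts∈polTables i)))

  preserves-polTablesFor⇒preserves : ∀ {n} (f : Op k (suc n)) {P : RelPair k} → P ∈ Σs →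
                                     Preserves f (diag (polTablesFor Σs P)) → Preserves f P
  preserves-polTablesFor⇒preserves {n} f {m , R , S} P∈Σs f-preserves rs rs∈R =
    trans (cong S (sym (tabulate-cong h-listing))) (h∈Pol P∈Σs listing listing-∈)
    where
    open Listing R (rs∈R fzero)
    N = suc (k ^ m)

    π : Fin (suc n) → Op k N
    π i x = lookup x (fsuc (encode (rs i)))

    π∈C : ∀ i → C (k ^ m) (π i)
    π∈C i = minor identity (λ _ → fsuc (encode (rs i)))

    ts : Fin (suc n) → Vec (Fin k) (k ^ N)
    ts i = table (π i)

    h∈Pol : Pol Σs N (fromTable N (apply f ts))
    h∈Pol = polTables-sound Σs {t = apply f ts}
      (f-preserves ts (λ i → table∈polTables Σs (π i) (C⊆Pol (π i) (π∈C i))))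

    π-listing : ∀ i y → π i (column listing y) ≡ lookup (rs i) y
    π-listing i y = trans (lookup∘tabulate (λ j → lookup (listing j) y) (fsuc (encode (rs i))))
                          (cong (λ v → lookup v y) (listing-encode (rs∈R i)))

    h-listing : ∀ y → fromTable N (apply f ts) (column listing y) ≡ f (column rs y)
    h-listing y = begin
      fromTable N (apply f ts) (column listing y)
        ≡⟨ fromTable-apply N f ts (column listing y) ⟩
      f (tabulate (λ i → fromTable N (ts i) (column listing y)))
        ≡⟨ cong f (tabulate-cong (λ i →
             trans (fromTable-table (π i) (column listing y)) (π-listing i y))) ⟩
      f (column rs y)
        ∎
      where open ≡-Reasoning

  C≐Pol-polTablesFor : C ≐Pol map diag (map (polTablesFor Σs) Σs)
  C≐Pol-polTablesFor n f =
    (λ f∈C → Pol-map-diag⁺ {f = f} (polTablesFor Σs) Σs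
               (λ {P} _ → C-preserves-polTables (k ^ proj₁ P) f f∈C)) ,
    (λ f∈Pol → Pol⊆C f (λ P∈Σs → preserves-polTablesFor⇒preserves f P∈Σs
                 (Pol-map-diag⁻ {f = f} (polTablesFor Σs) Σs f∈Pol P∈Σs)))

proposition3p2p5 : {ℓ : Level} (k : ℕ) (C : (n : ℕ) → Op k (suc n) → Set ℓ) →
    IsClone k C →
    (∃ λ (Σs : List (RelPair k)) → C ≐Pol Σs) ⇔
    (∃ λ (Σ′ : List (Σ ℕ (Rel k))) → C ≐Pol map diag Σ′)
proposition3p2p5 k C isClone =
  mk⇔ (λ (Σs , C≐Pol) → map (polTablesFor Σs) Σs , C≐Pol-polTablesFor isClone C≐Pol)
      (λ (Σ′ , C≐Pol) → map diag Σ′ , C≐Pol)
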